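{- For every integer $n\ge 1$, $|L_n(1)|=g(n-1)$ and $|L_n(2)|=g(n-1)$, where $g(m)=(2^m+1)(2^{m-1}+1)/3$ for $m\ge 0$ (so $g(0)=1$).
   Context: For $n\ge1$, let $L_n$ be the set of words $a=a_1a_2\cdots a_n$ of length $n$ over the alphabet $\{1,2,3,4\}$ such that $0<a_i\le \max_{0\le j<i}a_j+1$ for every $i$, with the convention $a_0=1$ (equivalently, the word $1a_1\cdots a_n$, with its leading letter $1$ dropped, satisfies the growth condition). Define $L_n(1)=\{a\in L_n: a_n=1\}$ and $L_n(2)=\{a\in L_n: a_n=\max_{0\le j<n}a_j+1 \text{ or } a_n=4\}$. -}

module Defs where

open import Data.Nat using (ℕ; zero; suc; _+_; _*_; _^_; _⊔_; _≤ᵇ_; _≡ᵇ_; _/_)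
open import Data.Bool using (Bool; true; false; _∧_; _∨_)
open import Data.List using (List; []; _∷_; map; concatMap; filterᵇ; length)
open import Data.Vec using (Vec; []; _∷_)

alphabet : List ℕ
alphabet = 1 ∷ 2 ∷ 3 ∷ 4 ∷ []

words : (n : ℕ) → List (Vec ℕ n)
words zero = [] ∷ []
words (suc n) = concatMap (λ a → map (a ∷_) (words n)) alphabet

growth : {n : ℕ} → ℕ → Vec ℕ n → Bool
growth m [] = true
growth m (a ∷ w) = (1 ≤ᵇ a) ∧ (a ≤ᵇ suc m) ∧ growth (m ⊔ a) w

-- Membership in L_n : the growth condition with the convention a_0 = 1.
inL : {n : ℕ} → Vec ℕ n → Bool
inL w = growth 1 w

lastIs1 : {n : ℕ} → Vec ℕ (suc n) → Bool
lastIs1 (a ∷ []) = a ≡ᵇ 1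
lastIs1 (a ∷ b ∷ w) = lastIs1 (b ∷ w)

lastNew : {n : ℕ} → ℕ → Vec ℕ (suc n) → Bool
lastNew m (a ∷ []) = (a ≡ᵇ suc m) ∨ (a ≡ᵇ 4)
lastNew m (a ∷ b ∷ w) = lastNew (m ⊔ a) (b ∷ w)

-- L_n(1) and L_n(2), for n = suc k ≥ 1, as explicit lists.
L1 : (n : ℕ) → List (Vec ℕ (suc n))
L1 n = filterᵇ (λ w → inL w ∧ lastIs1 w) (words (suc n))

L2 : (n : ℕ) → List (Vec ℕ (suc n))
L2 n = filterᵇ (λ w → inL w ∧ lastNew 1 w) (words (suc n))

-- g(m) = (2^m + 1)(2^(m-1) + 1)/3, with g(0) = 1.
-- For m ≥ 1 the quotient is exact; truncated ℕ division is used.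
g : ℕ → ℕ
g zero = 1
g (suc k) = ((2 ^ suc k + 1) * (2 ^ k + 1)) / 3

-- Classify the words of L_n by the running maximum m ∈ {1,2,3,4} of the
-- letters read so far.  For either last-letter condition the number X_n(m)
-- of admissible continuations of length n + 1 satisfies the same transfer
-- equation X_{n+1}(m) = Σ_{1 ≤ a ≤ m+1} X_n(max m a) with X_0 ≡ 1 on
-- {1,2,3,4}.  Its solution is X_n(4) = X_n(3) = 4^n, X_n(2) = (4^n + 2^n)/2
-- and X_n(1) = (4^n + 3·2^n + 2)/6, which equals g(n).
module Submission where

open import Defs
open import Data.Nat using (ℕ; zero; suc; _+_; _*_; _^_; _⊔_; _/_; _≤ᵇ_)
open import Data.Nat.Properties using (*-cancelˡ-≡)
open import Data.Nat.DivMod using (m*n/n≡m)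
open import Data.Nat.Tactic.RingSolver using (solve-∀)
open import Data.Bool using (Bool; true; false; _∧_; if_then_else_; T?)
open import Data.Bool.Properties using (∧-assoc)
open import Data.List using (List; []; _∷_; length; map; concatMap; filterᵇ; _++_)
open import Data.Nat.ListAction using (sum)
open import Data.List.Properties using (length-++; filter-++; map-cong)
open import Data.Vec using (Vec; _∷_)
open import Data.Product using (_×_; _,_)
open import Function using (_∘_)
open import Relation.Binary.PropositionalEquality using (_≡_; refl; sym; trans; cong; cong₂; module ≡-Reasoning)

open ≡-Reasoning

count : {A : Set} → (A → Bool) → List A → ℕ
count p xs = length (filterᵇ p xs)

count-++ : {A : Set} (p : A → Bool) (xs ys : List A) →
           count p (xs ++ ys) ≡ count p xs + count p ys
count-++ p xs ys = trans (cong length (filter-++ (T? ∘ p) xs ys)) (length-++ (filterᵇ p xs))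

count-map : {A B : Set} (p : B → Bool) (f : A → B) (xs : List A) →
            count p (map f xs) ≡ count (p ∘ f) xs
count-map p f [] = refl
count-map p f (x ∷ xs) with p (f x)
... | true  = cong suc (count-map p f xs)
... | false = count-map p f xs

count-concatMap : {A B : Set} (p : B → Bool) (f : A → List B) (xs : List A) →
                  count p (concatMap f xs) ≡ sum (map (count p ∘ f) xs)
count-concatMap p f [] = refl
count-concatMap p f (x ∷ xs) =
  trans (count-++ p (f x) (concatMap f xs)) (cong (count p (f x) +_) (count-concatMap p f xs))

count-cong : {A : Set} {p q : A → Bool} → (∀ x → p x ≡ q x) → (xs : List A) →
             count p xs ≡ count q xs
count-cong e [] = refl
count-cong {q = q} e (x ∷ xs) rewrite e x with q x
... | true  = cong suc (count-cong e xs)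
... | false = count-cong e xs

count-false : {A : Set} (xs : List A) → count (λ _ → false) xs ≡ 0
count-false []       = refl
count-false (x ∷ xs) = count-false xs

count-∧ˡ : {A : Set} (b : Bool) (q : A → Bool) (xs : List A) →
           count (λ x → b ∧ q x) xs ≡ (if b then count q xs else 0)
count-∧ˡ true  q xs = refl
count-∧ˡ false q xs = count-false xs

count-words-suc : ∀ {n} (p : Vec ℕ (suc n) → Bool) →
                  count p (words (suc n)) ≡ sum (map (λ a → count (p ∘ (a ∷_)) (words n)) alphabet)
count-words-suc {n} p =
  trans (count-concatMap p (λ a → map (a ∷_) (words n)) alphabet)
        (cong sum (map-cong (λ a → count-map p (a ∷_) (words n)) alphabet))

admissible : ℕ → ℕ → Bool
admissible m a = (1 ≤ᵇ a) ∧ (a ≤ᵇ suc m)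

growth-∷ : ∀ m a {n} (w : Vec ℕ n) → growth m (a ∷ w) ≡ admissible m a ∧ growth (m ⊔ a) w
growth-∷ m a w = sym (∧-assoc (1 ≤ᵇ a) (a ≤ᵇ suc m) (growth (m ⊔ a) w))

-- A condition on the last letter, given the maximum m of the letters before the word.
LastLetterCondition : Set
LastLetterCondition = ℕ → {n : ℕ} → Vec ℕ (suc n) → Bool

MaxDriven : LastLetterCondition → Set
MaxDriven K = ∀ m a {n} (w : Vec ℕ (suc n)) → K m (a ∷ w) ≡ K (m ⊔ a) w

growthCount : LastLetterCondition → ℕ → ℕ → ℕ
growthCount K n m = count (λ w → growth m w ∧ K m w) (words (suc n))

transfer : (ℕ → ℕ) → ℕ → ℕ
transfer f m = sum (map (λ a → if admissible m a then f (m ⊔ a) else 0) alphabet)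

module _ (K : LastLetterCondition) (K-max : MaxDriven K) where

  growthCount-∷ : ∀ n m a →
    count (λ w → growth m (a ∷ w) ∧ K m (a ∷ w)) (words (suc n))
      ≡ (if admissible m a then growthCount K n (m ⊔ a) else 0)
  growthCount-∷ n m a = begin
    count (λ w → growth m (a ∷ w) ∧ K m (a ∷ w)) (words (suc n))
      ≡⟨ count-cong split (words (suc n)) ⟩
    count (λ w → admissible m a ∧ (growth (m ⊔ a) w ∧ K (m ⊔ a) w)) (words (suc n))
      ≡⟨ count-∧ˡ (admissible m a) _ (words (suc n)) ⟩
    (if admissible m a then growthCount K n (m ⊔ a) else 0) ∎
    where
    split : ∀ w → growth m (a ∷ w) ∧ K m (a ∷ w) ≡ admissible m a ∧ (growth (m ⊔ a) w ∧ K (m ⊔ a) w)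
    split w = trans (cong₂ _∧_ (growth-∷ m a w) (K-max m a w))
                    (∧-assoc (admissible m a) (growth (m ⊔ a) w) (K (m ⊔ a) w))

  growthCount-suc : ∀ n m → growthCount K (suc n) m ≡ transfer (growthCount K n) m
  growthCount-suc n m =
    trans (count-words-suc {suc n} (λ w → growth m w ∧ K m w))
          (cong sum (map-cong (growthCount-∷ n m) alphabet))

quadruple : ∀ x → x * x + (x * x + (x * x + (x * x + 0))) ≡ (2 * x) * (2 * x)
quadruple = solve-∀

module _ (F : ℕ → ℕ → ℕ)
         (F-suc : ∀ n m → F (suc n) m ≡ transfer (F n) m)
         (F₁ : F 0 1 ≡ 1) (F₂ : F 0 2 ≡ 1) (F₃ : F 0 3 ≡ 1) (F₄ : F 0 4 ≡ 1) where

  closedForm₄ : ∀ n → F n 4 ≡ 2 ^ n * 2 ^ n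
  closedForm₄ zero    = F₄
  closedForm₄ (suc n) = begin
    F (suc n) 4                         ≡⟨ F-suc n 4 ⟩
    F n 4 + (F n 4 + (F n 4 + (F n 4 + 0)))
      ≡⟨ cong (λ x → x + (x + (x + (x + 0)))) (closedForm₄ n) ⟩
    x * x + (x * x + (x * x + (x * x + 0))) ≡⟨ quadruple x ⟩
    2 ^ suc n * 2 ^ suc n               ∎
    where x = 2 ^ n

  closedForm₃ : ∀ n → F n 3 ≡ 2 ^ n * 2 ^ n
  closedForm₃ zero    = F₃
  closedForm₃ (suc n) = begin
    F (suc n) 3                         ≡⟨ F-suc n 3 ⟩
    F n 3 + (F n 3 + (F n 3 + (F n 4 + 0)))
      ≡⟨ cong₂ (λ y z → y + (y + (y + (z + 0)))) (closedForm₃ n) (closedForm₄ n) ⟩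
    x * x + (x * x + (x * x + (x * x + 0))) ≡⟨ quadruple x ⟩
    2 ^ suc n * 2 ^ suc n               ∎
    where x = 2 ^ n

  closedForm₂ : ∀ n → 2 * F n 2 ≡ 2 ^ n * 2 ^ n + 2 ^ n
  closedForm₂ zero    = cong (2 *_) F₂
  closedForm₂ (suc n) = begin
    2 * F (suc n) 2                     ≡⟨ cong (2 *_) (F-suc n 2) ⟩
    2 * (F n 2 + (F n 2 + (F n 3 + 0))) ≡⟨ regroup (F n 2) (F n 3) ⟩
    2 * F n 2 + 2 * F n 2 + 2 * F n 3
      ≡⟨ cong₂ (λ y z → y + y + 2 * z) (closedForm₂ n) (closedForm₃ n) ⟩
    (x * x + x) + (x * x + x) + 2 * (x * x) ≡⟨ double x ⟩
    2 ^ suc n * 2 ^ suc n + 2 ^ suc n   ∎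
    where
    x = 2 ^ n
    regroup : ∀ y z → 2 * (y + (y + (z + 0))) ≡ 2 * y + 2 * y + 2 * z
    regroup = solve-∀
    double : ∀ x → (x * x + x) + (x * x + x) + 2 * (x * x) ≡ (2 * x) * (2 * x) + 2 * x
    double = solve-∀

  closedForm₁ : ∀ n → 6 * F n 1 ≡ 2 ^ n * 2 ^ n + 3 * 2 ^ n + 2
  closedForm₁ zero    = cong (6 *_) F₁
  closedForm₁ (suc n) = begin
    6 * F (suc n) 1                     ≡⟨ cong (6 *_) (F-suc n 1) ⟩
    6 * (F n 1 + (F n 2 + 0))           ≡⟨ regroup (F n 1) (F n 2) ⟩
    6 * F n 1 + 3 * (2 * F n 2)         ≡⟨ cong₂ (λ y z → y + 3 * z) (closedForm₁ n) (closedForm₂ n) ⟩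
    (x * x + 3 * x + 2) + 3 * (x * x + x) ≡⟨ double x ⟩
    2 ^ suc n * 2 ^ suc n + 3 * 2 ^ suc n + 2 ∎
    where
    x = 2 ^ n
    regroup : ∀ y z → 6 * (y + (z + 0)) ≡ 6 * y + 3 * (2 * z)
    regroup = solve-∀
    double : ∀ x → (x * x + 3 * x + 2) + 3 * (x * x + x) ≡ (2 * x) * (2 * x) + 3 * (2 * x) + 2
    double = solve-∀

  closedForm-g : ∀ k → F k 1 ≡ g k
  closedForm-g zero    = F₁
  closedForm-g (suc k) = begin
    F (suc k) 1                         ≡⟨ m*n/n≡m (F (suc k) 1) 3 ⟨
    F (suc k) 1 * 3 / 3                 ≡⟨ cong (_/ 3) thrice ⟨
    ((2 ^ suc k + 1) * (2 ^ k + 1)) / 3 ∎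
    where
    x = 2 ^ k
    expand : ∀ x → 2 * ((2 * x + 1) * (x + 1)) ≡ (2 * x) * (2 * x) + 3 * (2 * x) + 2
    expand = solve-∀
    six : ∀ y → 6 * y ≡ 2 * (y * 3)
    six = solve-∀
    thrice : (2 ^ suc k + 1) * (2 ^ k + 1) ≡ F (suc k) 1 * 3
    thrice = *-cancelˡ-≡ _ _ 2
      (trans (expand x) (trans (sym (closedForm₁ (suc k))) (six (F (suc k) 1))))

lastIs1-max : MaxDriven (λ _ → lastIs1)
lastIs1-max m a (b ∷ w) = refl

lastNew-max : MaxDriven (λ m → lastNew m)
lastNew-max m a (b ∷ w) = refl

mainTheorem1 : (k : ℕ) → (length (L1 k) ≡ g k) × (length (L2 k) ≡ g k)
mainTheorem1 k =
    closedForm-g (growthCount K₁) (growthCount-suc K₁ lastIs1-max) refl refl refl refl k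
  , closedForm-g (growthCount K₂) (growthCount-suc K₂ lastNew-max) refl refl refl refl k
  where
  K₁ K₂ : LastLetterCondition
  K₁ _ = lastIs1
  K₂ m = lastNew m
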